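{- Let $n$ be a positive integer and $v\in V_n$. If the shape $\mathsf{sh}(v)$ has two columns of the same height, then \[\big|\{w\in V_{n+1}:\varphi_n(w)=v\}\big|\le n.\]
   Context: $V_m\subseteq S_m$ is the set of permutations whose Schensted insertion produces no lateral bumps. Schensted insertion (French notation): insert $w_1,\dots,w_m$ successively into an initially empty tableau; a number $x$ inserted into a row is appended if it exceeds all entries (or the row is empty), otherwise it replaces the smallest entry $y>x$, and $y$ is bumped into the next row up and inserted by the same rule. A bump of $y$ from column $j$ is vertical if $y$ lands in column $j$ of the next row, and lateral otherwise. $\mathsf{sh}(v)$ is the shape (partition) of the Schensted insertion tableau of $v$; the height of column $j$ of a shape $\lambda$ is $|\{i:\lambda_i\ge j\}|$. For an injective word $a_1\cdots a_m$ of reals, $\mathsf{Flat}(a_1\cdots a_m)=b_1\cdots b_m$ with $b_i=|\{j:a_j\le a_i\}|$, and $\varphi_n:S_{n+1}\to S_n$ is $\varphi_n(w_1\cdots w_{n+1})=\mathsf{Flat}(w_1\cdots w_n)$. -}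

module Defs where

open import Data.Nat using (ℕ; zero; suc; _≤_; _<_; _≤ᵇ_; _<ᵇ_; _≡ᵇ_)
open import Data.Bool using (Bool; true; false; _∨_; not; if_then_else_)
open import Data.List using (List; []; _∷_; length; map; filter; upTo; foldl; take; head)
open import Data.List.Relation.Binary.Permutation.Propositional using (_↭_)
open import Data.Maybe using (Maybe; just; nothing)
open import Data.Product using (_×_; _,_; ∃-syntax)
open import Relation.Binary.PropositionalEquality using (_≡_; _≢_)

-- Tableaux (French notation): a list of rows, the first being the bottom row;
-- each row is listed left to right (column 0 first).
Row : Set
Row = List ℕ

Tableau : Set
Tableau = List Row

-- Result of inserting x into a row:
-- new row, the (0-based) column where x was placed, and the bumped entry if any
-- (the bumped entry was in that same column).
record RowResult : Set where
  constructor rr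
  field
    newRow : Row
    col    : ℕ
    bumped : Maybe ℕ

open RowResult public

rowInsert : ℕ → Row → RowResult
rowInsert x [] = rr (x ∷ []) 0 nothing
rowInsert x (y ∷ ys) with x <ᵇ y
... | true  = rr (x ∷ ys) 0 (just y)
... | false with rowInsert x ys
...   | rr r c b = rr (y ∷ r) (suc c) b

-- The first argument
-- is the column from which x was bumped (nothing for the initial insertion
-- into the bottom row). The Bool records whether a lateral bump occurred.
insertT : Maybe ℕ → ℕ → Tableau → Tableau × Bool
insertT c x [] = (x ∷ []) ∷ [] , lateral c 0
  where
  lateral : Maybe ℕ → ℕ → Bool
  lateral nothing  _ = false
  lateral (just j) p = not (j ≡ᵇ p)
insertT c x (r ∷ rs) with rowInsert x r
... | rr r' p nothing  = r' ∷ rs , lat c p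
  where
  lat : Maybe ℕ → ℕ → Bool
  lat nothing  _ = false
  lat (just j) q = not (j ≡ᵇ q)
... | rr r' p (just y) with insertT (just p) y rs
...   | rs' , l = r' ∷ rs' , (lat c p ∨ l)
  where
  lat : Maybe ℕ → ℕ → Bool
  lat nothing  _ = false
  lat (just j) q = not (j ≡ᵇ q)

schensted : List ℕ → Tableau × Bool
schensted = foldl step ([] , false)
  where
  step : Tableau × Bool → ℕ → Tableau × Bool
  step (t , b) x with insertT nothing x t
  ... | t' , b' = t' , (b ∨ b')

insTableau : List ℕ → Tableau
insTableau w with schensted w
... | t , _ = t

hasLateral : List ℕ → Bool
hasLateral w with schensted w
... | _ , b = b

-- Permutations of [1..m] in one-line notation.
IsPerm : ℕ → List ℕ → Set
IsPerm m w = w ↭ map suc (upTo m)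

V : ℕ → List ℕ → Set
V m w = IsPerm m w × hasLateral w ≡ false

sh : List ℕ → List ℕ
sh w = map length (insTableau w)

-- Height of column j (1-based) of a shape λ: |{ i : λ_i ≥ j }|.
colHeight : List ℕ → ℕ → ℕ
colHeight sh j = length (filter (λ l → j Data.Nat.≤? l) sh)

numCols : List ℕ → ℕ
numCols [] = 0
numCols (l ∷ _) = l

TwoColsSameHeight : List ℕ → Set
TwoColsSameHeight s =
  ∃[ j ] ∃[ k ] (1 ≤ j × j ≤ numCols s × 1 ≤ k × k ≤ numCols s × j ≢ k
                 × colHeight s j ≡ colHeight s k)

Flat : List ℕ → List ℕ
Flat a = map (λ ai → length (filter (λ aj → aj Data.Nat.≤? ai) a)) a

φ : ℕ → List ℕ → List ℕ
φ n w = Flat (take n w)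

module Submission where

-- Every w ∈ S_{n+1} with φ_n(w) = v is determined by its last letter x: it is v
-- relabelled order-preservingly to skip the value x, followed by x. So there are at most
-- n + 1 such w, and it suffices to find one of them with a lateral bump.
--
-- Equal heights of columns j < k force every column in between to have the same height,
-- so no row of sh(v) has length j (1 ≤ j < λ₁). Let a be the entry in column j + 1 of the
-- bottom row of P(v). Schensted insertion commutes with order-preserving relabelling, so
-- inserting the final letter a of the extension ending in a bumps the relabelled a, namely
-- a + 1, out of that column. A vertical bump only continues upwards, and since no row has
-- length j the bumped letter can never come to rest in that column: a lateral bump occurs.

open import Defs
open import Data.Bool using (Bool; true; false; _∨_; if_then_else_)
open import Data.Bool.Properties using (∨-zeroʳ)
open import Data.Nat
  using (ℕ; zero; suc; _+_; _⊓_; _≤_; _<_; _≮_; _<ᵇ_; _≡ᵇ_; z≤n; s≤s; s≤s⁻¹; _≤?_)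
open import Data.Nat.Properties
  using (module ≤-Reasoning; ≤-refl; ≤-trans; <-trans; <-≤-trans; <⇒≤; ≤⇒≯; <⇒≯; <⇒≱;
         ≰⇒>; ≮⇒≥; ≤∧≢⇒<; <-irrefl; <-cmp; n<1+n; n≤1+n; m<n⇒m<1+n; m≤n⇒m<n∨m≡n;
         +-comm; +-identityʳ; suc-injective; m≤n⇒m⊓n≡m; m≥n⇒m⊓n≡n;
         <ᵇ-reflects-<; <ᵇ⇒<; <⇒<ᵇ; ≡ᵇ⇒≡; ≡⇒≡ᵇ; _≟_)
open import Data.List using (List; []; _∷_; _++_; _∷ʳ_; [_]; length; map; filter; take; upTo)
open import Data.List.Properties
  using (map-++; map-∘; map-cong; map-id-local; length-map; length-++; length-++-sucʳ;
         foldl-++; filter-accept; filter-reject; filter-++; upTo-∷ʳ; length-upTo)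
open import Data.List.Reverse using (Reverse; []; _∶_∶ʳ_; reverseView)
open import Data.List.Membership.Propositional using (_∈_; _∉_)
open import Data.List.Membership.Propositional.Properties
  using (∈-map⁺; ∈-map⁻; ∈-upTo⁻; ∈-++⁺ˡ; ∈-++⁺ʳ; ∈-++⁻; ∈-∃++)
open import Data.List.Relation.Unary.Any using (here; there)
open import Data.List.Relation.Unary.All using (All; []; _∷_)
import Data.List.Relation.Unary.All as All
open import Data.List.Relation.Unary.All.Properties using (++⁻; All¬⇒¬Any)
open import Data.List.Relation.Unary.AllPairs using (AllPairs; []; _∷_)
open import Data.List.Relation.Unary.Unique.Propositional using (Unique)
import Data.List.Relation.Unary.Unique.Propositional.Properties as Unique
open import Data.List.Relation.Binary.Permutation.Propositional using (_↭_; ↭-sym; ↭⇒↭ₛ)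
open import Data.List.Relation.Binary.Permutation.Propositional.Properties
  using (∷↭∷ʳ; ↭-length; filter-↭; ∈-resp-↭)
import Data.List.Relation.Binary.Permutation.Setoid.Properties as Permutationₛ
open import Data.List.Relation.Binary.Sublist.Propositional using (⊆-refl)
open import Data.List.Relation.Binary.Sublist.Propositional.Properties using (filter⁺)
open import Data.List.Relation.Binary.Sublist.Heterogeneous.Properties using (length-mono-≤)
import Data.Maybe as Maybe
open import Data.Maybe using (just; nothing)
open import Data.Product using (_×_; _,_; proj₁; proj₂; map₁; map₂; ∃)
open import Data.Sum using (inj₁; inj₂; [_,_]′)
open import Function using (id; _∘_)
open import Relation.Binary.Core using (_Preserves_⟶_)
open import Relation.Binary.Definitions using (tri<; tri≈; tri>)
open import Relation.Binary.PropositionalEquality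
  using (_≡_; _≢_; refl; sym; trans; cong; subst; setoid; module ≡-Reasoning)
open import Relation.Nullary using (¬_; yes; no; contradiction)
open import Relation.Nullary.Reflects using (ofʸ; ofⁿ; det; fromEquivalence)

<⇒<ᵇ≡true : ∀ {m n} → m < n → (m <ᵇ n) ≡ true
<⇒<ᵇ≡true {m} {n} m<n = det (<ᵇ-reflects-< m n) (ofʸ m<n)

≮⇒<ᵇ≡false : ∀ {m n} → m ≮ n → (m <ᵇ n) ≡ false
≮⇒<ᵇ≡false {m} {n} m≮n = det (<ᵇ-reflects-< m n) (ofⁿ m≮n)

≢⇒≡ᵇ≡false : ∀ {m n} → m ≢ n → (m ≡ᵇ n) ≡ false
≢⇒≡ᵇ≡false {m} {n} m≢n = det (fromEquivalence (≡ᵇ⇒≡ m n) (≡⇒≡ᵇ m n)) (ofⁿ m≢n)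

unique⇒length≤ : ∀ {A : Set} {xs ys : List A} → Unique xs → All (_∈ ys) xs → length xs ≤ length ys
unique⇒length≤ {xs = []} _ _ = z≤n
unique⇒length≤ {xs = x ∷ xs} (x≢xs ∷ xs-unique) (x∈ys ∷ xs⊆ys) with ∈-∃++ x∈ys
... | ys₁ , ys₂ , refl = subst (suc (length xs) ≤_) (sym (length-++-sucʳ ys₁ x ys₂))
  (s≤s (unique⇒length≤ xs-unique (All.zipWith (λ (x≢y , y∈) → remove y∈ x≢y) (x≢xs , xs⊆ys))))
  where
  remove : ∀ {y} → y ∈ ys₁ ++ x ∷ ys₂ → x ≢ y → y ∈ ys₁ ++ ys₂
  remove y∈ x≢y with ∈-++⁻ ys₁ y∈
  ... | inj₁ y∈ys₁         = ∈-++⁺ˡ y∈ys₁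
  ... | inj₂ (here refl)   = contradiction refl x≢y
  ... | inj₂ (there y∈ys₂) = ∈-++⁺ʳ ys₁ y∈ys₂

splitAt-< : ∀ {A : Set} (xs : List A) {i} → i < length xs →
            ∃ λ pre → ∃ λ a → ∃ λ post → xs ≡ pre ++ a ∷ post × length pre ≡ i
splitAt-< (x ∷ xs) {zero}  _         = [] , x , xs , refl , refl
splitAt-< (x ∷ xs) {suc i} (s≤s i<n) with splitAt-< xs i<n
... | pre , a , post , refl , refl = x ∷ pre , a , post , refl , refl

AllPairs-++-∷⁻ : ∀ {A : Set} {R : A → A → Set} xs {a ys} →
                 AllPairs R (xs ++ a ∷ ys) → All (λ x → R x a) xs
AllPairs-++-∷⁻ []       _            = []
AllPairs-++-∷⁻ (x ∷ xs) (Rx ∷ pairs) =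
  All.lookup Rx (∈-++⁺ʳ xs (here refl)) ∷ AllPairs-++-∷⁻ xs pairs

Unique-resp-↭ : ∀ {A : Set} {xs ys : List A} → xs ↭ ys → Unique xs → Unique ys
Unique-resp-↭ {A} p = Permutationₛ.Unique-resp-↭ (setoid A) (↭⇒↭ₛ p)

Unique-∷ʳ⁻ : ∀ {A : Set} (w : List A) x → Unique (w ∷ʳ x) → Unique w × x ∉ w
Unique-∷ʳ⁻ w x u with Unique-resp-↭ (↭-sym (∷↭∷ʳ x w)) u
... | x≢w ∷ w-unique = w-unique , All¬⇒¬Any x≢w

take-length-∷ʳ : ∀ {A : Set} (u : List A) x → take (length u) (u ∷ʳ x) ≡ u
take-length-∷ʳ []      x = refl
take-length-∷ʳ (y ∷ u) x = cong (y ∷_) (take-length-∷ʳ u x)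

range : ℕ → List ℕ
range m = map suc (upTo m)

range-suc : ∀ m → range (suc m) ≡ range m ∷ʳ suc m
range-suc m = trans (cong (map suc) (sym (upTo-∷ʳ m))) (map-++ suc (upTo m) [ m ])

length-range : ∀ m → length (range m) ≡ m
length-range m = trans (length-map suc (upTo m)) (length-upTo m)

∈-range⁻ : ∀ {m c} → c ∈ range m → c ≤ m
∈-range⁻ c∈ with ∈-map⁻ suc c∈
... | i , i∈ , refl = ∈-upTo⁻ i∈

∈-range-suc : ∀ {m c} → c ∈ range m → c ∈ range (suc m)
∈-range-suc {m} c∈ = subst (_ ∈_) (sym (range-suc m)) (∈-++⁺ˡ c∈)

range-unique : ∀ m → Unique (range m)
range-unique m = Unique.map⁺ suc-injective (Unique.upTo⁺ m)

-- Chosen so that Flat u is map (rank u) u by definition.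
rank : List ℕ → ℕ → ℕ
rank u c = length (filter (_≤? c) u)

rank-++ : ∀ u u′ c → rank (u ++ u′) c ≡ rank u c + rank u′ c
rank-++ u u′ c = trans (cong length (filter-++ (_≤? c) u u′)) (length-++ (filter (_≤? c) u))

rank-↭ : ∀ {u u′} c → u ↭ u′ → rank u c ≡ rank u′ c
rank-↭ c p = ↭-length (filter-↭ (_≤? c) p)

rank-[]-≤ : ∀ {x c} → x ≤ c → rank [ x ] c ≡ 1
rank-[]-≤ {c = c} x≤c = cong length (filter-accept (_≤? c) x≤c)

rank-[]-≰ : ∀ {x c} → ¬ x ≤ c → rank [ x ] c ≡ 0
rank-[]-≰ {c = c} x≰c = cong length (filter-reject (_≤? c) x≰c)

rank-range : ∀ m c → rank (range m) c ≡ m ⊓ c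
rank-range zero    c = refl
rank-range (suc m) c = begin
  rank (range (suc m)) c              ≡⟨ cong (λ u → rank u c) (range-suc m) ⟩
  rank (range m ∷ʳ suc m) c           ≡⟨ rank-++ (range m) [ suc m ] c ⟩
  rank (range m) c + rank [ suc m ] c ≡⟨ cong (_+ rank [ suc m ] c) (rank-range m c) ⟩
  m ⊓ c + rank [ suc m ] c            ≡⟨ last-step ⟩
  suc m ⊓ c                           ∎
  where
  open ≡-Reasoning
  last-step : m ⊓ c + rank [ suc m ] c ≡ suc m ⊓ c
  last-step with suc m ≤? c
  ... | yes m<c rewrite rank-[]-≤ m<c | m≤n⇒m⊓n≡m (<⇒≤ m<c) | m≤n⇒m⊓n≡m m<c = +-comm m 1
  ... | no m≮c
    rewrite rank-[]-≰ m≮c | m≥n⇒m⊓n≡n (s≤s⁻¹ (≰⇒> m≮c)) | m≥n⇒m⊓n≡n (<⇒≤ (≰⇒> m≮c)) =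
    +-identityʳ c

rank-perm : ∀ {m w c} → IsPerm m w → c ∈ w → rank w c ≡ c
rank-perm {m} {w} {c} p c∈w =
  trans (rank-↭ c p) (trans (rank-range m c) (m≥n⇒m⊓n≡n (∈-range⁻ (∈-resp-↭ p c∈w))))

punchIn : ℕ → ℕ → ℕ
punchIn a b = if b <ᵇ a then b else suc b

punchIn-< : ∀ {a b} → b < a → punchIn a b ≡ b
punchIn-< b<a rewrite <⇒<ᵇ≡true b<a = refl

punchIn-≥ : ∀ {a b} → a ≤ b → punchIn a b ≡ suc b
punchIn-≥ a≤b rewrite ≮⇒<ᵇ≡false (≤⇒≯ a≤b) = refl

punchIn-mono-< : ∀ a → punchIn a Preserves _<_ ⟶ _<_
punchIn-mono-< a {x} {y} x<y with x <ᵇ a | <ᵇ-reflects-< x a | y <ᵇ a | <ᵇ-reflects-< y a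
... | true  | _       | true  | _       = x<y
... | true  | _       | false | _       = m<n⇒m<1+n x<y
... | false | ofⁿ x≮a | true  | ofʸ y<a = contradiction (<-trans x<y y<a) x≮a
... | false | _       | false | _       = s≤s x<y

punchIn-rank : ∀ {x c} k → c ≢ x → k + rank [ x ] c ≡ c → punchIn x k ≡ c
punchIn-rank {x} {c} k c≢x k+r≡c with x ≤? c
... | yes x≤c rewrite rank-[]-≤ x≤c | +-comm k 1 =
  trans (punchIn-≥ (s≤s⁻¹ (subst (x <_) (sym k+r≡c) (≤∧≢⇒< x≤c (c≢x ∘ sym))))) k+r≡c
... | no x≰c rewrite rank-[]-≰ x≰c | +-identityʳ k =
  trans (punchIn-< (subst (_< x) (sym k+r≡c) (≰⇒> x≰c))) k+r≡c

punchIn-Flat : ∀ {m} u x → IsPerm m (u ∷ʳ x) → map (punchIn x) (Flat u) ≡ u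
punchIn-Flat u x p = trans (sym (map-∘ u)) (map-id-local (All.tabulate inverse))
  where
  x∉u : x ∉ u
  x∉u = proj₂ (Unique-∷ʳ⁻ u x (Unique-resp-↭ (↭-sym p) (range-unique _)))
  inverse : ∀ {c} → c ∈ u → punchIn x (rank u c) ≡ c
  inverse {c} c∈u = punchIn-rank {x} (rank u c) (λ { refl → x∉u c∈u })
    (trans (sym (rank-++ u [ x ] c)) (rank-perm p (∈-++⁺ˡ c∈u)))

extend : ℕ → List ℕ → List ℕ
extend a v = map (punchIn a) v ∷ʳ a

Extension : ℕ → List ℕ → List ℕ → Set
Extension m v w = ∃ λ x → x ∈ range m × w ≡ extend x v

φ-fibre : ∀ {n v} w → IsPerm (suc n) w → φ n w ≡ v → Extension (suc n) v w
φ-fibre {n} {v} w = go (reverseView w)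
  where
  go : ∀ {w} → Reverse w → IsPerm (suc n) w → φ n w ≡ v → Extension (suc n) v w
  go [] p _ = contradiction (trans (↭-length p) (length-range (suc n))) λ ()
  go (u ∶ _ ∶ʳ x) p φ≡v = x , ∈-resp-↭ p (∈-++⁺ʳ u (here refl)) , cong (_∷ʳ x) u≡
    where
    open ≡-Reasoning
    |u|≡n : length u ≡ n
    |u|≡n = suc-injective (begin
      suc (length u)         ≡⟨ +-comm 1 (length u) ⟩
      length u + 1           ≡⟨ sym (length-++ u) ⟩
      length (u ∷ʳ x)        ≡⟨ ↭-length p ⟩
      length (range (suc n)) ≡⟨ length-range (suc n) ⟩
      suc n                  ∎)
    u≡ : u ≡ map (punchIn x) v
    u≡ = begin
      u                                       ≡⟨ sym (punchIn-Flat u x p) ⟩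
      map (punchIn x) (Flat u)
        ≡⟨ cong (map (punchIn x) ∘ Flat) (sym (take-length-∷ʳ u x)) ⟩
      map (punchIn x) (φ (length u) (u ∷ʳ x))
        ≡⟨ cong (λ k → map (punchIn x) (φ k (u ∷ʳ x))) |u|≡n ⟩
      map (punchIn x) (φ n (u ∷ʳ x))          ≡⟨ cong (map (punchIn x)) φ≡v ⟩
      map (punchIn x) v                       ∎

colHeight-antitone : ∀ s {i k} → i ≤ k → colHeight s k ≤ colHeight s i
colHeight-antitone s {i} {k} i≤k =
  length-mono-≤ (filter⁺ (k ≤?_) (i ≤?_) (λ { refl k≤l → ≤-trans i≤k k≤l }) (⊆-refl {x = s}))

colHeight-∷-≤ : ∀ {j} l s → j ≤ l → colHeight (l ∷ s) j ≡ suc (colHeight s j)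
colHeight-∷-≤ {j} l s j≤l = cong length (filter-accept (j ≤?_) j≤l)

colHeight-∷-≰ : ∀ {j} l s → ¬ j ≤ l → colHeight (l ∷ s) j ≡ colHeight s j
colHeight-∷-≰ {j} l s j≰l = cong length (filter-reject (j ≤?_) j≰l)

colHeight-≤-∷ : ∀ {j} l s → colHeight s j ≤ colHeight (l ∷ s) j
colHeight-≤-∷ {j} l s with j ≤? l
... | yes j≤l rewrite colHeight-∷-≤ l s j≤l = n≤1+n _
... | no  j≰l rewrite colHeight-∷-≰ l s j≰l = ≤-refl

colHeight-suc-< : ∀ {j} s → j ∈ s → colHeight s (suc j) < colHeight s j
colHeight-suc-< {j} (j ∷ s) (here refl)
  rewrite colHeight-∷-≰ j s (<-irrefl refl) | colHeight-∷-≤ j s ≤-refl =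
  s≤s (colHeight-antitone s (n≤1+n j))
colHeight-suc-< {j} (l ∷ s) (there j∈s) with suc j ≤? l
... | yes j<l rewrite colHeight-∷-≤ l s j<l | colHeight-∷-≤ l s (<⇒≤ j<l) =
  s≤s (colHeight-suc-< s j∈s)
... | no  j≮l rewrite colHeight-∷-≰ l s j≮l =
  <-≤-trans (colHeight-suc-< s j∈s) (colHeight-≤-∷ l s)

equal-colHeights⇒∉ : ∀ {j k} s → j < k → colHeight s j ≡ colHeight s k → j ∉ s
equal-colHeights⇒∉ {j} {k} s j<k hⱼ≡hₖ j∈s = <⇒≱ (colHeight-suc-< s j∈s) (begin
  colHeight s j       ≡⟨ hⱼ≡hₖ ⟩
  colHeight s k       ≤⟨ colHeight-antitone s j<k ⟩
  colHeight s (suc j) ∎)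
  where open ≤-Reasoning

missing-row-length : ∀ s → TwoColsSameHeight s → ∃ λ i → 1 ≤ i × i < numCols s × i ∉ s
missing-row-length s (j , k , 1≤j , j≤λ₁ , 1≤k , k≤λ₁ , j≢k , hⱼ≡hₖ) with <-cmp j k
... | tri< j<k _ _ = j , 1≤j , <-≤-trans j<k k≤λ₁ , equal-colHeights⇒∉ s j<k hⱼ≡hₖ
... | tri≈ _ j≡k _ = contradiction j≡k j≢k
... | tri> _ _ k<j = k , 1≤k , <-≤-trans k<j j≤λ₁ , equal-colHeights⇒∉ s k<j (sym hⱼ≡hₖ)

-- The step function of schensted, which is local to its definition.
insertStep : Tableau × Bool → ℕ → Tableau × Bool
insertStep (t , l) x = map₂ (l ∨_) (insertT nothing x t)

schensted-∷ʳ : ∀ w x → schensted (w ∷ʳ x) ≡ insertStep (schensted w) x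
schensted-∷ʳ w x = foldl-++ _ _ w [ x ]

module _ {f : ℕ → ℕ} (f-mono : f Preserves _<_ ⟶ _<_) where

  <ᵇ-preserved : ∀ x y → (f x <ᵇ f y) ≡ (x <ᵇ y)
  <ᵇ-preserved x y = det (<ᵇ-reflects-< (f x) (f y))
    (fromEquivalence (f-mono ∘ <ᵇ⇒< x y) (<⇒<ᵇ ∘ <-reflected))
    where
    ≤-preserved : ∀ {x y} → x ≤ y → f x ≤ f y
    ≤-preserved x≤y = [ <⇒≤ ∘ f-mono , (λ { refl → ≤-refl }) ]′ (m≤n⇒m<n∨m≡n x≤y)
    <-reflected : f x < f y → x < y
    <-reflected fx<fy = ≰⇒> (λ y≤x → ≤⇒≯ (≤-preserved y≤x) fx<fy)

  mapRowResult : RowResult → RowResult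
  mapRowResult (rr r c b) = rr (map f r) c (Maybe.map f b)

  rowInsert-map : ∀ x r → rowInsert (f x) (map f r) ≡ mapRowResult (rowInsert x r)
  rowInsert-map x [] = refl
  rowInsert-map x (y ∷ ys) rewrite <ᵇ-preserved x y with x <ᵇ y
  ... | true  = refl
  ... | false rewrite rowInsert-map x ys = refl

  insertT-map : ∀ c x t → insertT c (f x) (map (map f) t) ≡ map₁ (map (map f)) (insertT c x t)
  insertT-map c x [] = refl
  insertT-map c x (r ∷ rs) rewrite rowInsert-map x r with rowInsert x r
  ... | rr r′ p nothing  = refl
  ... | rr r′ p (just y) rewrite insertT-map (just p) y rs = refl

  schensted-map : ∀ w → schensted (map f w) ≡ map₁ (map (map f)) (schensted w)
  schensted-map w = go (reverseView w)
    where
    go : ∀ {w} → Reverse w → schensted (map f w) ≡ map₁ (map (map f)) (schensted w)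
    go [] = refl
    go (w ∶ w′ ∶ʳ x) = begin
      schensted (map f (w ∷ʳ x))                          ≡⟨ cong schensted (map-++ f w [ x ]) ⟩
      schensted (map f w ∷ʳ f x)                          ≡⟨ schensted-∷ʳ (map f w) (f x) ⟩
      insertStep (schensted (map f w)) (f x)              ≡⟨ cong (λ s → insertStep s (f x)) (go w′) ⟩
      insertStep (map₁ (map (map f)) (schensted w)) (f x)
        ≡⟨ cong (map₂ (hasLateral w ∨_)) (insertT-map nothing x (insTableau w)) ⟩
      map₁ (map (map f)) (insertStep (schensted w) x)
        ≡⟨ cong (map₁ (map (map f))) (sym (schensted-∷ʳ w x)) ⟩
      map₁ (map (map f)) (schensted (w ∷ʳ x))             ∎
      where open ≡-Reasoning

bottomRow : Tableau → Row
bottomRow []      = []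
bottomRow (r ∷ _) = r

bottomRow-insertT : ∀ c x t → bottomRow (proj₁ (insertT c x t)) ≡ newRow (rowInsert x (bottomRow t))
bottomRow-insertT c x [] = refl
bottomRow-insertT c x (r ∷ rs) with rowInsert x r
... | rr r′ p nothing  = refl
... | rr r′ p (just y) = refl

bottomRow-∷ʳ : ∀ w x → bottomRow (insTableau (w ∷ʳ x)) ≡ newRow (rowInsert x (bottomRow (insTableau w)))
bottomRow-∷ʳ w x =
  trans (cong (bottomRow ∘ proj₁) (schensted-∷ʳ w x)) (bottomRow-insertT nothing x (insTableau w))

rowInsert-All : ∀ {P : ℕ → Set} {x} r → P x → All P r → All P (newRow (rowInsert x r))
rowInsert-All []       px []         = px ∷ []
rowInsert-All {x = x} (y ∷ ys) px (py ∷ pys) with x <ᵇ y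
... | true  = px ∷ pys
... | false = py ∷ rowInsert-All ys px pys

rowInsert-increasing : ∀ {x} r → x ∉ r → AllPairs _<_ r → AllPairs _<_ (newRow (rowInsert x r))
rowInsert-increasing [] _ [] = [] ∷ []
rowInsert-increasing {x} (y ∷ ys) x∉ (y<ys ∷ ys↑) with x <ᵇ y | <ᵇ-reflects-< x y
... | true  | ofʸ x<y = All.map (<-trans x<y) y<ys ∷ ys↑
... | false | ofⁿ x≮y = rowInsert-All ys y<x y<ys ∷ rowInsert-increasing ys (x∉ ∘ there) ys↑
  where
  y<x : y < x
  y<x = ≤∧≢⇒< (≮⇒≥ x≮y) (λ y≡x → x∉ (here (sym y≡x)))

bottomRow-All : ∀ {P : ℕ → Set} w → All P w → All P (bottomRow (insTableau w))
bottomRow-All {P} w = go (reverseView w)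
  where
  go : ∀ {w} → Reverse w → All P w → All P (bottomRow (insTableau w))
  go [] _ = []
  go (w ∶ w′ ∶ʳ x) pwx with ++⁻ w pwx
  ... | pw , px ∷ [] = subst (All P) (sym (bottomRow-∷ʳ w x)) (rowInsert-All _ px (go w′ pw))

bottomRow-increasing : ∀ w → Unique w → AllPairs _<_ (bottomRow (insTableau w))
bottomRow-increasing w = go (reverseView w)
  where
  go : ∀ {w} → Reverse w → Unique w → AllPairs _<_ (bottomRow (insTableau w))
  go [] _ = []
  go (w ∶ w′ ∶ʳ x) wx-unique with Unique-∷ʳ⁻ w x wx-unique
  ... | w-unique , x∉w = subst (AllPairs _<_) (sym (bottomRow-∷ʳ w x))
    (rowInsert-increasing _ (x∉w ∘ All.lookup (bottomRow-All w (All.tabulate id))) (go w′ w-unique))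

shape : Tableau → List ℕ
shape = map length

shape-map : ∀ f t → shape (map (map f) t) ≡ shape t
shape-map f t = trans (sym (map-∘ t)) (map-cong (length-map f) t)

rowInsert-unbumped⇒col≡length : ∀ x r → bumped (rowInsert x r) ≡ nothing → col (rowInsert x r) ≡ length r
rowInsert-unbumped⇒col≡length x []       _ = refl
rowInsert-unbumped⇒col≡length x (y ∷ ys) e with x <ᵇ y
rowInsert-unbumped⇒col≡length x (y ∷ ys) () | true
... | false = cong suc (rowInsert-unbumped⇒col≡length x ys e)

-- A letter bumped from (0-based) column j keeps being bumped vertically, or it lands
-- laterally; it can come to rest in column j only by being appended to a row of length j.
insertT-lateral : ∀ {j} y rs → 1 ≤ j → j ∉ shape rs → proj₂ (insertT (just j) y rs) ≡ true
insertT-lateral {suc j} y [] _ _ = refl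
insertT-lateral {j} y (r ∷ rs) 1≤j j∉ with rowInsert y r in eq | rowInsert-unbumped⇒col≡length y r
... | rr r′ p nothing | appended with j ≟ p
...   | yes refl = contradiction (here (appended refl)) j∉
...   | no  j≢p rewrite ≢⇒≡ᵇ≡false j≢p = refl
insertT-lateral {j} y (r ∷ rs) 1≤j j∉ | rr r′ p (just y′) | _ with j ≟ p
...   | yes refl rewrite insertT-lateral y′ rs 1≤j (j∉ ∘ there) = ∨-zeroʳ _
...   | no  j≢p rewrite ≢⇒≡ᵇ≡false j≢p = refl

insertT-bumped : ∀ {x r′ p y} r rs → rowInsert x r ≡ rr r′ p (just y) →
                 proj₂ (insertT nothing x (r ∷ rs)) ≡ proj₂ (insertT (just p) y rs)
insertT-bumped r rs eq rewrite eq = refl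

rowInsert-punchIn : ∀ {a} pre post → All (_< a) pre →
  rowInsert a (map (punchIn a) (pre ++ a ∷ post))
    ≡ rr (pre ++ a ∷ map (punchIn a) post) (length pre) (just (suc a))
rowInsert-punchIn {a} [] post []
  rewrite punchIn-≥ (≤-refl {a}) | <⇒<ᵇ≡true (n<1+n a) = refl
rowInsert-punchIn {a} (y ∷ pre) post (y<a ∷ pre<a)
  rewrite punchIn-< y<a | ≮⇒<ᵇ≡false (<⇒≯ y<a) | rowInsert-punchIn pre post pre<a = refl

hasLateral-extend : ∀ a v →
  hasLateral (extend a v) ≡ hasLateral v ∨ proj₂ (insertT nothing a (map (map (punchIn a)) (insTableau v)))
hasLateral-extend a v = begin
  hasLateral (extend a v)
    ≡⟨ cong proj₂ (schensted-∷ʳ (map (punchIn a) v) a) ⟩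
  proj₂ (insertStep (schensted (map (punchIn a) v)) a)
    ≡⟨ cong (λ s → proj₂ (insertStep s a)) (schensted-map (punchIn-mono-< a) v) ⟩
  proj₂ (insertStep (map₁ (map (map (punchIn a))) (schensted v)) a) ∎
  where open ≡-Reasoning

extend-lateral : ∀ {v pre a post rs} → insTableau v ≡ (pre ++ a ∷ post) ∷ rs →
                 All (_< a) pre → 1 ≤ length pre → length pre ∉ shape rs →
                 hasLateral (extend a v) ≡ true
extend-lateral {v} {pre} {a} {post} {rs} P≡ pre<a 1≤i i∉rs = begin
  hasLateral (extend a v)
    ≡⟨ hasLateral-extend a v ⟩
  hasLateral v ∨ proj₂ (insertT nothing a (map (map (punchIn a)) (insTableau v)))
    ≡⟨ cong (λ t → hasLateral v ∨ proj₂ (insertT nothing a (map (map (punchIn a)) t))) P≡ ⟩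
  hasLateral v ∨ proj₂ (insertT nothing a (r′ ∷ rs′))
    ≡⟨ cong (hasLateral v ∨_) (insertT-bumped r′ rs′ (rowInsert-punchIn pre post pre<a)) ⟩
  hasLateral v ∨ proj₂ (insertT (just (length pre)) (suc a) rs′)
    ≡⟨ cong (hasLateral v ∨_) (insertT-lateral (suc a) rs′ 1≤i i∉rs′) ⟩
  hasLateral v ∨ true
    ≡⟨ ∨-zeroʳ _ ⟩
  true ∎
  where
  open ≡-Reasoning
  r′ : Row
  r′ = map (punchIn a) (pre ++ a ∷ post)
  rs′ : Tableau
  rs′ = map (map (punchIn a)) rs
  i∉rs′ : length pre ∉ shape rs′
  i∉rs′ rewrite shape-map (punchIn a) rs = i∉rs

lateral-extension : ∀ {n v} → V n v → TwoColsSameHeight (sh v) →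
                    ∃ λ a → a ∈ range n × hasLateral (extend a v) ≡ true
lateral-extension {n} {v} (v-perm , _) twoCols with insTableau v in P≡
... | [] with _ , _ , () , _ ← missing-row-length [] twoCols
lateral-extension {n} {v} (v-perm , _) twoCols | r ∷ rs
  with i , 1≤i , i<λ₁ , i∉ ← missing-row-length (shape (r ∷ rs)) twoCols
  with pre , a , post , refl , refl ← splitAt-< r i<λ₁ =
  a , a∈range , extend-lateral {v} P≡ (AllPairs-++-∷⁻ pre r-increasing) 1≤i (i∉ ∘ there)
  where
  r-increasing : AllPairs _<_ (pre ++ a ∷ post)
  r-increasing = subst (AllPairs _<_ ∘ bottomRow) P≡
    (bottomRow-increasing v (Unique-resp-↭ (↭-sym v-perm) (range-unique n)))
  a∈range : a ∈ range n
  a∈range = All.lookup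
    (subst (All (_∈ range n) ∘ bottomRow) P≡ (bottomRow-All v (All.tabulate (∈-resp-↭ v-perm))))
    (∈-++⁺ʳ pre (here refl))

lemma3p12 : (n : ℕ) → 1 ≤ n → (v : List ℕ) → V n v → TwoColsSameHeight (sh v)
    → (ws : List (List ℕ)) → Unique ws → All (λ w → V (suc n) w × φ n w ≡ v) ws
    → length ws ≤ n
lemma3p12 n _ v V-v twoCols ws ws-unique ws-fibre
  with a , a∈range , lateral ← lateral-extension V-v twoCols = s≤s⁻¹ (begin
    length (extend a v ∷ ws)   ≤⟨ unique⇒length≤ (extendₐ∉ws ∷ ws-unique) (extendₐ∈ ∷ ws⊆) ⟩
    length (map candidate [1…n+1]) ≡⟨ length-map candidate [1…n+1] ⟩
    length [1…n+1]             ≡⟨ length-range (suc n) ⟩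
    suc n                      ∎)
  where
  open ≤-Reasoning
  [1…n+1] : List ℕ
  [1…n+1] = range (suc n)
  candidate : ℕ → List ℕ
  candidate x = extend x v
  extendₐ∉ws : All (extend a v ≢_) ws
  extendₐ∉ws = All.map
    (λ { ((_ , no-lateral) , _) refl → contradiction (trans (sym lateral) no-lateral) λ () }) ws-fibre
  extendₐ∈ : extend a v ∈ map candidate [1…n+1]
  extendₐ∈ = ∈-map⁺ candidate (∈-range-suc a∈range)
  candidate-∈ : ∀ {w} → Extension (suc n) v w → w ∈ map candidate [1…n+1]
  candidate-∈ (x , x∈ , refl) = ∈-map⁺ candidate x∈
  ws⊆ : All (_∈ map candidate [1…n+1]) ws
  ws⊆ = All.map (λ { {w} ((w-perm , _) , φw≡v) → candidate-∈ (φ-fibre w w-perm φw≡v) }) ws-fibre
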